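{- If $\mathbb{F}$ is an n-frame (resp.~c-frame), then $\mathbb{F} \cong (\mathbb{F}^\star)_\star$. Moreover, if $\mathbb{K}$ is a supported two-sorted n-frame (resp.~c-frame), then $\mathbb{K}\cong \mathbb{F}^\star$ for some n-frame (resp.~c-frame) $\mathbb{F}$ iff $\mathbb{K} \cong (\mathbb{K}_\star)^\star$.
   Context: An n-frame is a pair $(W,\nu)$ with $W\neq\emptyset$ and $\nu:W\to\mathcal{P}(\mathcal{P}(W))$ such that each $\nu(w)$ is upward closed; a c-frame is a pair $(W,f)$ with $f:W\times\mathcal{P}(W)\to\mathcal{P}(W)$. A two-sorted n-frame is $\mathbb{K}=(X,Y,R_\ni,R_{\not\ni},R_\nu,R_{\nu^c})$ with $X,Y$ nonempty, $R_\ni,R_{\not\ni}\subseteq Y\times X$, $R_\nu,R_{\nu^c}\subseteq X\times Y$; it is supported if $R_\nu^{ -1}[(R_\ni^{ -1}[D^c])^c]=(R_{\nu^c}^{ -1}[(R_{\not\ni}^{ -1}[D])^c])^c$ for all $D\subseteq X$. A two-sorted c-frame is $\mathbb{K}=(X,Y,R_\ni,R_{\not\ni},T_f)$ with $T_f\subseteq X\times Y\times X$. For an n-frame $\mathbb{F}=(W,\nu)$, $\mathbb{F}^\star=(W,\mathcal{P}(W),R_\ni,R_{\not\ni},R_\nu,R_{\nu^c})$ with $xR_\nu Z$ iff $Z\in\nu(x)$, $xR_{\nu^c}Z$ iff $Z\notin\nu(x)$, $ZR_\ni x$ iff $x\in Z$, $ZR_{\not\ni}x$ iff $x\notin Z$;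 for a c-frame $\mathbb{F}=(W,f)$, $\mathbb{F}^\star=(W,\mathcal{P}(W),R_\ni,R_{\not\ni},T_f)$ with $R_\ni,R_{\not\ni}$ as before and $T_f(x,Z,x')$ iff $x'\in f(x,Z)$. For a supported two-sorted n-frame $\mathbb{K}$, $\mathbb{K}_\star=(X,\nu_\star)$ with $\nu_\star(x)=\{D\subseteq X\mid x\in R_\nu^{ -1}[(R_\ni^{ -1}[D^c])^c]\}$; for a two-sorted c-frame $\mathbb{K}$, $\mathbb{K}_\star=(X,f_\star)$ with $f_\star(x,D)=\bigcap\{C\subseteq X\mid x\in T_f^{(0)}[\{C\},D^c]\}$, where $T_f^{(0)}[U,D']=\{s\mid\exists t\exists u(T_f(s,t,u)\ \&\ t\in U\ \&\ u\in D')\}$. (Equivalently $\mathbb{F}^\star$ and $\mathbb{K}_\star$ arise by composing complex-algebra/associated-frame dualities with the algebraic constructions $(\cdot)^\bullet$, $(\cdot)_\bullet$.) -}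

module Defs where

open import Data.Bool using (Bool; true; false)
open import Data.Product using (Σ; _×_; _,_; proj₁; proj₂)
open import Relation.Nullary using (¬_; Dec; yes; no)
open import Relation.Binary.PropositionalEquality using (_≡_; refl; sym; trans)
open import Function.Bundles using (_⇔_; _↔_; Inverse)
open import Level using (0ℓ)
open import Axiom.Extensionality.Propositional using (Extensionality)

-- Conventions
-- * Subsets of a carrier A (elements of P(A)) are Bool-valued functions A → Bool.
-- * Subsets of P(A) (like ν(w)) and relations are Set-valued predicates.
-- * The metatheory is classical: the main theorem assumes function
--   extensionality and excluded middle (as Dec for every Set).

Subset : Set → Set
Subset A = A → Bool

⟦_⟧ : {A : Set} → Subset A → A → Set
⟦ D ⟧ a = D a ≡ true

_ᶜ : {A : Set} → Subset A → A → Set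
(D ᶜ) a = D a ≡ false

_⊆_ : {A : Set} → Subset A → Subset A → Set
Z ⊆ Z' = ∀ a → Z a ≡ true → Z' a ≡ true

_⁻¹[_] : {A B : Set} → (A → B → Set) → (B → Set) → A → Set
_⁻¹[_] {A} {B} R U a = Σ B λ b → R a b × U b

∁ : {A : Set} → (A → Set) → A → Set
∁ P a = ¬ P a

LEM : Set₁
LEM = (P : Set) → Dec P

Funext : Set₁
Funext = Extensionality 0ℓ 0ℓ

record NFrame : Set₁ where
  field
    W        : Set
    nonempty : W
    ν        : W → Subset W → Set
    upward   : ∀ w Z Z' → Z ⊆ Z' → ν w Z → ν w Z'

record CFrame : Set₁ where
  field
    W        : Set
    nonempty : W
    f        : W → Subset W → Subset W

-- isomorphisms (bijection g preserving the structure; g[Z] = Z ∘ g⁻¹)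
record _≅n_ (F F' : NFrame) : Set where
  private
    module F  = NFrame F
    module F' = NFrame F'
  field
    g   : F.W ↔ F'.W
    pres : ∀ w (Z : Subset F.W) →
           F.ν w Z ⇔ F'.ν (Inverse.to g w) (λ v → Z (Inverse.from g v))

record _≅c_ (F F' : CFrame) : Set where
  private
    module F  = CFrame F
    module F' = CFrame F'
  field
    g   : F.W ↔ F'.W
    pres : ∀ w (Z : Subset F.W) v →
           F.f w Z v ≡ F'.f (Inverse.to g w) (λ u → Z (Inverse.from g u)) (Inverse.to g v)

record TwoSortedN : Set₁ where
  field
    X    : Set
    Y    : Set
    xne  : X
    yne  : Y
    R∋   : Y → X → Set
    R∌   : Y → X → Set
    Rν   : X → Y → Set
    Rνᶜ  : X → Y → Set

record TwoSortedC : Set₁ where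
  field
    X    : Set
    Y    : Set
    xne  : X
    yne  : Y
    R∋   : Y → X → Set
    R∌   : Y → X → Set
    Tf   : X → Y → X → Set

Supported : TwoSortedN → Set
Supported K = ∀ (D : Subset X) x →
  (Rν ⁻¹[ ∁ (R∋ ⁻¹[ D ᶜ ]) ]) x ⇔ ∁ (Rνᶜ ⁻¹[ ∁ (R∌ ⁻¹[ ⟦ D ⟧ ]) ]) x
  where open TwoSortedN K

record _≅tn_ (K K' : TwoSortedN) : Set where
  private
    module K  = TwoSortedN K
    module K' = TwoSortedN K'
  field
    gX : K.X ↔ K'.X
    gY : K.Y ↔ K'.Y
    pres∋  : ∀ y x → K.R∋ y x ⇔ K'.R∋ (Inverse.to gY y) (Inverse.to gX x)
    pres∌  : ∀ y x → K.R∌ y x ⇔ K'.R∌ (Inverse.to gY y) (Inverse.to gX x)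
    presν  : ∀ x y → K.Rν x y ⇔ K'.Rν (Inverse.to gX x) (Inverse.to gY y)
    presνᶜ : ∀ x y → K.Rνᶜ x y ⇔ K'.Rνᶜ (Inverse.to gX x) (Inverse.to gY y)

record _≅tc_ (K K' : TwoSortedC) : Set where
  private
    module K  = TwoSortedC K
    module K' = TwoSortedC K'
  field
    gX : K.X ↔ K'.X
    gY : K.Y ↔ K'.Y
    pres∋  : ∀ y x → K.R∋ y x ⇔ K'.R∋ (Inverse.to gY y) (Inverse.to gX x)
    pres∌  : ∀ y x → K.R∌ y x ⇔ K'.R∌ (Inverse.to gY y) (Inverse.to gX x)
    presT  : ∀ x y x' → K.Tf x y x' ⇔ K'.Tf (Inverse.to gX x) (Inverse.to gY y) (Inverse.to gX x')

_⋆n : NFrame → TwoSortedN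
F ⋆n = record
  { X = W ; Y = Subset W ; xne = nonempty ; yne = λ _ → false
  ; R∋ = λ Z x → Z x ≡ true
  ; R∌ = λ Z x → Z x ≡ false
  ; Rν = λ x Z → ν x Z
  ; Rνᶜ = λ x Z → ¬ ν x Z }
  where open NFrame F

_⋆c : CFrame → TwoSortedC
F ⋆c = record
  { X = W ; Y = Subset W ; xne = nonempty ; yne = λ _ → false
  ; R∋ = λ Z x → Z x ≡ true
  ; R∌ = λ Z x → Z x ≡ false
  ; Tf = λ x Z x' → f x Z x' ≡ true }
  where open CFrame F

ν⋆ : (K : TwoSortedN) → TwoSortedN.X K → Subset (TwoSortedN.X K) → Set
ν⋆ K x D = (Rν ⁻¹[ ∁ (R∋ ⁻¹[ D ᶜ ]) ]) x
  where open TwoSortedN K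

private
  bool-lemma : ∀ {b c : Bool} → (b ≡ true → c ≡ true) → c ≡ false → b ≡ false
  bool-lemma {false} _ _ = refl
  bool-lemma {true} h e with trans (sym (h refl)) e
  ... | ()

ν⋆-upward : (K : TwoSortedN) → ∀ x Z Z' → Z ⊆ Z' → ν⋆ K x Z → ν⋆ K x Z'
ν⋆-upward K x Z Z' sub (y , r , h) =
  y , r , λ { (x' , r' , e) → h (x' , r' , bool-lemma (sub x') e) }

_⋆N : TwoSortedN → NFrame
K ⋆N = record
  { W = TwoSortedN.X K ; nonempty = TwoSortedN.xne K
  ; ν = ν⋆ K ; upward = ν⋆-upward K }

T⁰ : (K : TwoSortedC) → (TwoSortedC.Y K → Set) → (TwoSortedC.X K → Set) →
     TwoSortedC.X K → Set
T⁰ K U D' s = Σ Y λ t → Σ X λ u → Tf s t u × U t × D' u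
  where open TwoSortedC K

-- the elements of Y representing D ⊆ X:  [∋]D ∩ [∌]D
-- (in F⋆ this is exactly the singleton {D})
Rep : (K : TwoSortedC) → Subset (TwoSortedC.X K) → TwoSortedC.Y K → Set
Rep K D y = (∀ x → R∋ y x → D x ≡ true) × (∀ x → R∌ y x → D x ≡ false)
  where open TwoSortedC K

InF⋆ : (K : TwoSortedC) → TwoSortedC.X K → Subset (TwoSortedC.X K) →
       TwoSortedC.X K → Set
InF⋆ K x₀ D x = ∀ (C : Subset X) → ¬ T⁰ K (Rep K D) (C ᶜ) x₀ → C x ≡ true
  where open TwoSortedC K

decToBool : {P : Set} → Dec P → Bool
decToBool (yes _) = true
decToBool (no _)  = false

-- K⋆ (uses excluded middle to turn the intersection into a Bool-valued subset)
⋆C : LEM → TwoSortedC → CFrame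
⋆C lem K = record
  { W = TwoSortedC.X K ; nonempty = TwoSortedC.xne K
  ; f = λ x D x' → decToBool (lem (InF⋆ K x D x')) }

{-# OPTIONS --safe #-}
module Submission where

open import Defs
open import Data.Bool using (Bool; true; false)
open import Data.Bool.Properties using (¬-not)
open import Data.Product using (Σ; _×_; _,_)
open import Function.Base using (_∘_)
open import Function.Bundles using (_⇔_; _↔_; Inverse; Equivalence; Injection; mk⇔; mk↔ₛ′)
open import Function.Construct.Composition using (_⇔-∘_; _↔-∘_)
open import Function.Construct.Identity using (⇔-id; ↔-id)
open import Function.Construct.Symmetry using (⇔-sym)
open import Function.Properties.Inverse using (↔⇒↣)
open import Function.Related.TypeIsomorphisms using (¬-cong-⇔)
open import Relation.Nullary using (¬_; Dec; yes; no; contradiction)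
open import Relation.Binary.PropositionalEquality using (_≡_; refl; sym; trans; cong; subst)

-- In a two-sorted frame isomorphic to
-- some 𝔽⋆, every y : Y is determined by the subset of X it contains, and the
-- structure relation at y is the single-sorted structure at that subset; so
-- rebuilding the frame from 𝕂⋆ only renames Y along y ↦ R∋[y]. For n-frames
-- the passage from R_ν to ν⋆ needs upward closure of ν; for c-frames, f⋆(x, D)
-- collapses to the T_f-successors of x through the elements representing D,
-- and in 𝔽⋆ the only such element is D itself. The single-sorted round trip
-- 𝔽 ≅ (𝔽⋆)⋆ is the case 𝕂 = 𝔽⋆ with the identity isomorphism.

private variable
  A B : Set

open Equivalence using (to; from)

decToBool-true⇔ : {P : Set} (d : Dec P) → decToBool d ≡ true ⇔ P
decToBool-true⇔ (yes p) = mk⇔ (λ _ → p) (λ _ → refl)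
decToBool-true⇔ (no ¬p) = mk⇔ (λ ()) (λ p → contradiction p ¬p)

≡-decToBool : {P : Set} {b : Bool} (d : Dec P) → (b ≡ true ⇔ P) → b ≡ decToBool d
≡-decToBool (yes p) b⇔P = from b⇔P p
≡-decToBool (no ¬p) b⇔P = ¬-not (¬p ∘ to b⇔P)

∁⁻¹[ᶜ]⇔⊆ : (R : A → B → Set) {D : Subset B} {a : A} →
           ∁ (R ⁻¹[ D ᶜ ]) a ⇔ (∀ b → R a b → D b ≡ true)
∁⁻¹[ᶜ]⇔⊆ R = mk⇔ (λ ¬R⁻¹ b r → ¬-not (λ e → ¬R⁻¹ (b , r , e)))
               (λ R⊆D (b , r , e) → contradiction (trans (sym (R⊆D b r)) e) λ ())

⊆-via-↔ : (g : A ↔ B) {D D' : Subset B} →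
          (∀ a → D (Inverse.to g a) ≡ true → D' (Inverse.to g a) ≡ true) → D ⊆ D'
⊆-via-↔ g {D} {D'} D⊆D' b e =
  subst (λ b' → D' b' ≡ true) (Inverse.strictlyInverseˡ g b)
        (D⊆D' (Inverse.from g b) (subst (λ b' → D b' ≡ true) (sym (Inverse.strictlyInverseˡ g b)) e))

precompose-↔ : Funext → A ↔ B → Subset B ↔ Subset A
precompose-↔ fe g = mk↔ₛ′ (λ D → D ∘ Inverse.to g) (λ D → D ∘ Inverse.from g)
  (λ D → fe (cong D ∘ Inverse.strictlyInverseʳ g))
  (λ D → fe (cong D ∘ Inverse.strictlyInverseˡ g))

≅tn-refl : (K : TwoSortedN) → K ≅tn K
≅tn-refl K = record
  { gX = ↔-id _ ; gY = ↔-id _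
  ; pres∋ = λ _ _ → ⇔-id _ ; pres∌ = λ _ _ → ⇔-id _
  ; presν = λ _ _ → ⇔-id _ ; presνᶜ = λ _ _ → ⇔-id _ }

≅tc-refl : (K : TwoSortedC) → K ≅tc K
≅tc-refl K = record
  { gX = ↔-id _ ; gY = ↔-id _
  ; pres∋ = λ _ _ → ⇔-id _ ; pres∌ = λ _ _ → ⇔-id _
  ; presT = λ _ _ _ → ⇔-id _ }

module ≅⋆n {K : TwoSortedN} {F : NFrame} (i : K ≅tn (F ⋆n)) where
  open TwoSortedN K
  open _≅tn_ i

  extent : Y → Subset X
  extent y = Inverse.to gY y ∘ Inverse.to gX

  Rν⇔ν⋆ : ∀ x y → Rν x y ⇔ ν⋆ K x (extent y)
  Rν⇔ν⋆ x y = mk⇔ forth back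
    where
    forth : Rν x y → ν⋆ K x (extent y)
    forth r = y , r , from (∁⁻¹[ᶜ]⇔⊆ R∋) (λ x' → to (pres∋ y x'))
    back : ν⋆ K x (extent y) → Rν x y
    back (y' , r' , ∋y'⊆) = from (presν x y) (NFrame.upward F _ _ _ y'⊆y (to (presν x y') r'))
      where
      y'⊆y : Inverse.to gY y' ⊆ Inverse.to gY y
      y'⊆y = ⊆-via-↔ gX λ x' → to (∁⁻¹[ᶜ]⇔⊆ R∋) ∋y'⊆ x' ∘ from (pres∋ y' x')

  extent-↔ : Funext → Y ↔ Subset X
  extent-↔ fe = precompose-↔ fe gX ↔-∘ gY

  ≅⋆N⋆n : Funext → K ≅tn ((K ⋆N) ⋆n)
  ≅⋆N⋆n fe = record
    { gX = ↔-id _ ; gY = extent-↔ fe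
    ; pres∋ = pres∋ ; pres∌ = pres∌
    ; presν = Rν⇔ν⋆
    ; presνᶜ = λ x y → ¬-cong-⇔ (Rν⇔ν⋆ x y ⇔-∘ ⇔-sym (presν x y)) ⇔-∘ presνᶜ x y }

InF⋆⇔Rep-successor : LEM → (K : TwoSortedC) → ∀ {x D x'} →
  InF⋆ K x D x' ⇔ Σ (TwoSortedC.Y K) (λ t → Rep K D t × TwoSortedC.Tf K x t x')
InF⋆⇔Rep-successor lem K {x} {D} = mk⇔
  (λ x'∈f⋆ → to (decToBool-true⇔ (lem _)) (x'∈f⋆ successors no-escape))
  (λ (t , rep , tf) C ¬T⁰ → ¬-not (λ e → ¬T⁰ (t , _ , tf , rep , e)))
  where
  open TwoSortedC K
  -- the least C with x ∉ T⁰[Rep D, Cᶜ]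
  successors : Subset X
  successors u = decToBool (lem (Σ Y λ t → Rep K D t × Tf x t u))
  no-escape : ¬ T⁰ K (Rep K D) (successors ᶜ) x
  no-escape (t , u , tf , rep , e) =
    contradiction (trans (sym (from (decToBool-true⇔ (lem _)) (t , rep , tf))) e) λ ()

module ≅⋆c (fe : Funext) (lem : LEM) {K : TwoSortedC} {F : CFrame} (i : K ≅tc (F ⋆c)) where
  open TwoSortedC K
  open _≅tc_ i

  extent-↔ : Y ↔ Subset X
  extent-↔ = precompose-↔ fe gX ↔-∘ gY

  extent : Y → Subset X
  extent = Inverse.to extent-↔

  Rep-extent : ∀ y → Rep K (extent y) y
  Rep-extent y = (λ x → to (pres∋ y x)) , (λ x → to (pres∌ y x))

  Rep-extent-unique : ∀ {y t} → Rep K (extent y) t → t ≡ y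
  Rep-extent-unique {y} {t} (∋t⊆ , ∌t⊆) =
    Injection.injective (↔⇒↣ extent-↔) (fe extent-agree)
    where
    extent-agree : ∀ x → extent t x ≡ extent y x
    extent-agree x with extent t x in e
    ... | true  = sym (∋t⊆ x (from (pres∋ t x) e))
    ... | false = sym (∌t⊆ x (from (pres∌ t x) e))

  Tf⇔InF⋆ : ∀ x y x' → Tf x y x' ⇔ InF⋆ K x (extent y) x'
  Tf⇔InF⋆ x y x' = ⇔-sym (InF⋆⇔Rep-successor lem K) ⇔-∘
    mk⇔ (λ tf → y , Rep-extent y , tf)
        (λ (t , rep , tf) → subst (λ s → Tf x s x') (Rep-extent-unique rep) tf)

  ≅⋆C⋆c : K ≅tc ((⋆C lem K) ⋆c)
  ≅⋆C⋆c = record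
    { gX = ↔-id _ ; gY = extent-↔
    ; pres∋ = pres∋ ; pres∌ = pres∌
    ; presT = λ x y x' → ⇔-sym (decToBool-true⇔ (lem _)) ⇔-∘ Tf⇔InF⋆ x y x' }

NFrame-≅⋆n⋆N : (F : NFrame) → F ≅n ((F ⋆n) ⋆N)
NFrame-≅⋆n⋆N F = record { g = ↔-id _ ; pres = ≅⋆n.Rν⇔ν⋆ {F = F} (≅tn-refl (F ⋆n)) }

CFrame-≅⋆c⋆C : Funext → (lem : LEM) → (F : CFrame) → F ≅c (⋆C lem (F ⋆c))
CFrame-≅⋆c⋆C fe lem F = record
  { g = ↔-id _
  ; pres = λ w Z v → ≡-decToBool (lem _) (≅⋆c.Tf⇔InF⋆ fe lem (≅tc-refl (F ⋆c)) w Z v) }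

mainTheorem8 : Funext → (lem : LEM) →
    ((F : NFrame) → F ≅n ((F ⋆n) ⋆N))
    × ((K : TwoSortedN) → Supported K →
        (Σ NFrame (λ F → K ≅tn (F ⋆n))) ⇔ (K ≅tn ((K ⋆N) ⋆n)))
    × ((F : CFrame) → F ≅c (⋆C lem (F ⋆c)))
    × ((K : TwoSortedC) →
        (Σ CFrame (λ F → K ≅tc (F ⋆c))) ⇔ (K ≅tc ((⋆C lem K) ⋆c)))
mainTheorem8 fe lem =
    NFrame-≅⋆n⋆N
  , (λ K _ → mk⇔ (λ (F , i) → ≅⋆n.≅⋆N⋆n {F = F} i fe) (K ⋆N ,_))
  , CFrame-≅⋆c⋆C fe lem
  , (λ K → mk⇔ (λ (F , i) → ≅⋆c.≅⋆C⋆c fe lem i) (⋆C lem K ,_))
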